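{- Let $I$ be an interval-poset of size $n$. Then the distance $\mathrm{dist}(I)$ equals the number of Tamari inversions of $I$, where a Tamari inversion is a pair $(a,b)$ with $1\le a<b\le n$ such that there is no $k$ with $a\le k<b$ and $b\triangleleft k$, and there is no $k$ with $a<k\le b$ and $a\triangleleft k$.
   Context: An interval-poset of size $n$ is a partial order $\triangleleft$ on $\{1,\dots,n\}$ such that for all $a<b<c$: $a\triangleleft c\Rightarrow b\triangleleft c$ and $c\triangleleft a\Rightarrow b\triangleleft a$. Binary tree nodes are $v_1,\dots,v_n$ in in-order; the Tamari order on binary trees of size $n$ is the reflexive-transitive closure of right rotations $y(x(A,B),C)\to x(A,y(B,C))$. Interval-posets of size $n$ are in bijection with Tamari intervals $[T_1,T_2]$ ($T_1\le T_2$): the interval-poset has, for $a<b$, $b\triangleleft a$ iff $v_b$ is in the right subtree of $v_a$ in $T_1$, and $a\triangleleft b$ iff $v_a$ is in the left subtree of $v_b$ in $T_2$. The distance $\mathrm{dist}(I)$ is the maximal length $k-1$ of a chain $T_1=P_1<P_2<\dots<P_k=T_2$ in the Tamari lattice. -}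

module Defs where

open import Data.Nat using (ℕ; zero; suc; _+_; _≤_; _<_)
open import Data.Fin using (Fin; toℕ)
open import Data.Product using (Σ; _×_; _,_)
open import Data.List using (List; length)
open import Data.List.Relation.Unary.Unique.Propositional using (Unique)
open import Data.List.Membership.Propositional using (_∈_)
open import Relation.Binary.PropositionalEquality using (_≡_; _≢_)
open import Relation.Binary.Construct.Closure.ReflexiveTransitive using (Star)
open import Function.Bundles using (_⇔_)
open import Relation.Nullary using (¬_)

-- Binary trees; nodes are labelled 0,1,…,size-1 in in-order
-- (label i here corresponds to node v_{i+1} of the paper).

data Tree : Set where
  leaf : Tree
  node : Tree → Tree → Tree

size : Tree → ℕ
size leaf       = 0
size (node l r) = suc (size l + size r)

data _⟶_ : Tree → Tree → Set where
  rot   : ∀ {A B C} → node (node A B) C ⟶ node A (node B C)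
  left  : ∀ {l l′ r} → l ⟶ l′ → node l r ⟶ node l′ r
  right : ∀ {l r r′} → r ⟶ r′ → node l r ⟶ node l r′

_≤T_ : Tree → Tree → Set
_≤T_ = Star _⟶_

_<T_ : Tree → Tree → Set
S <T T = S ≤T T × S ≢ T

-- Chain P₁ < P₂ < … < P_k from S to T, indexed by its length k-1.
data Chain : Tree → Tree → ℕ → Set where
  done : ∀ {T} → Chain T T 0
  step : ∀ {S U T k} → S <T U → Chain U T k → Chain S T (suc k)

IsDist : Tree → Tree → ℕ → Set
IsDist S T d = Chain S T d × (∀ k → Chain S T k → k ≤ d)

-- InRight off t a b : node b lies in the right subtree of node a in t.
data InRight : ℕ → Tree → ℕ → ℕ → Set where
  here  : ∀ {off l r a b} → a ≡ off + size l → a < b → b ≤ a + size r →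
          InRight off (node l r) a b
  inL   : ∀ {off l r a b} → InRight off l a b → InRight off (node l r) a b
  inR   : ∀ {off l r a b} → InRight (suc (off + size l)) r a b →
          InRight off (node l r) a b

-- InLeft off t a b : node a lies in the left subtree of node b in t.
data InLeft : ℕ → Tree → ℕ → ℕ → Set where
  here  : ∀ {off l r a b} → b ≡ off + size l → off ≤ a → a < b →
          InLeft off (node l r) a b
  inL   : ∀ {off l r a b} → InLeft off l a b → InLeft off (node l r) a b
  inR   : ∀ {off l r a b} → InLeft (suc (off + size l)) r a b →
          InLeft off (node l r) a b

-- Interval-posets on {1,…,n}, represented on Fin n (element i ↦ i+1).

Rel : ℕ → Set₁
Rel n = Fin n → Fin n → Set

record IsIntervalPoset {n : ℕ} (_◁_ : Rel n) : Set where
  field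
    refl◁    : ∀ a → a ◁ a
    antisym◁ : ∀ a b → a ◁ b → b ◁ a → a ≡ b
    trans◁   : ∀ a b c → a ◁ b → b ◁ c → a ◁ c
    incr     : ∀ a b c → toℕ a < toℕ b → toℕ b < toℕ c → a ◁ c → b ◁ c
    decr     : ∀ a b c → toℕ a < toℕ b → toℕ b < toℕ c → c ◁ a → b ◁ a

Corresponds : {n : ℕ} → Rel n → Tree → Tree → Set
Corresponds {n} _◁_ T₁ T₂ =
  ∀ (a b : Fin n) → toℕ a < toℕ b →
    ((b ◁ a) ⇔ InRight 0 T₁ (toℕ a) (toℕ b)) ×
    ((a ◁ b) ⇔ InLeft 0 T₂ (toℕ a) (toℕ b))

TamariInversion : {n : ℕ} → Rel n → Fin n × Fin n → Set
TamariInversion {n} _◁_ (a , b) =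
  toℕ a < toℕ b ×
  (¬ Σ (Fin n) λ k → toℕ a ≤ toℕ k × toℕ k < toℕ b × b ◁ k) ×
  (¬ Σ (Fin n) λ k → toℕ a < toℕ k × toℕ k ≤ toℕ b × a ◁ k)

HasCard : {A : Set} → (A → Set) → ℕ → Set
HasCard {A} P k =
  Σ (List A) λ L → Unique L × (∀ x → (x ∈ L) ⇔ P x) × length L ≡ k

module Submission where

-- Encode a binary tree by its right-end vector  rightmost t a  (the largest
-- label in the subtree rooted at a).  This vector determines the tree, it
-- expresses both subtree relations of the interval-poset, and a right rotation
-- with pivot x changes it only at x: the right end of x jumps to the right end
-- of the label following its old subtree.  So right ends grow along ≤T.
-- For vectors g ≤ f call (a,b) an inversion when a < b ≤ f a and g k < b for
-- all a ≤ k < b.  Every rotation below T₂ destroys at least one inversion of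
-- (g , rightmost T₂) and creates none, giving the upper bound on chains; while
-- S ≠ T₂, a well-chosen rotation destroys exactly one, giving a chain of that
-- length.  Finally the Tamari inversions of the interval-poset of [T₁,T₂] are
-- exactly the inversions of (rightmost T₁ , rightmost T₂), counted by
-- filtering all pairs of labels.

open import Defs
open import Data.Nat using (ℕ; zero; suc; _+_; _≤_; _<_; z≤n; s≤s; _≤?_; _<?_)
open import Data.Nat.Properties
open import Data.Fin using (Fin; toℕ; fromℕ<)
open import Data.Fin.Properties using (toℕ-fromℕ<; toℕ-injective; toℕ<n)
open import Data.Product using (Σ; _×_; _,_; proj₁; proj₂)
open import Data.Sum using (_⊎_; inj₁; inj₂)
open import Data.Empty using (⊥; ⊥-elim)
open import Data.List using (List; []; _∷_; length; filter; cartesianProduct; allFin; upTo)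
open import Data.List.Properties using (filter-none)
open import Data.List.Relation.Unary.Any using (here; there)
open import Data.List.Relation.Unary.All using (_∷_)
import Data.List.Relation.Unary.All as All
import Data.List.Relation.Unary.AllPairs as AllPairs
open import Data.List.Relation.Unary.Unique.Propositional using (Unique)
import Data.List.Relation.Unary.Unique.Propositional.Properties as Unique
open import Data.List.Membership.Propositional using (_∈_)
open import Data.List.Membership.Propositional.Properties
  using (∈-filter⁺; ∈-filter⁻; ∈-cartesianProduct⁺; ∈-allFin; ∈-upTo⁺; ∈-upTo⁻)
open import Data.List.Extrema.Nat using (argmin; argmin-all; f[argmin]≤f[⊤]; f[argmin]≤f[xs])
open import Relation.Binary.PropositionalEquality
  using (_≡_; _≢_; refl; sym; trans; cong; cong₂; subst; subst₂; module ≡-Reasoning)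
open import Relation.Binary.Construct.Closure.ReflexiveTransitive using (ε; _◅_; _◅◅_)
open import Relation.Binary using (Tri; tri<; tri≈; tri>)
open import Relation.Nullary using (¬_; Dec; yes; no)
open import Relation.Nullary.Decidable using (_×-dec_; _→-dec_)
open import Function.Bundles using (mk⇔; Equivalence)

-- Right ends of subtrees.  A tree with offset `off` carries the labels
-- off, …, off + size t - 1 in in-order; its root is off + size l.

rightmost : ℕ → Tree → ℕ → ℕ
rightmost off leaf a = a
rightmost off (node l r) a with <-cmp a (off + size l)
... | tri< _ _ _ = rightmost off l a
... | tri≈ _ _ _ = a + size r
... | tri> _ _ _ = rightmost (suc (off + size l)) r a

rightmost-left : ∀ {off l r a} → a < off + size l →
                 rightmost off (node l r) a ≡ rightmost off l a
rightmost-left {off} {l} {r} {a} a<ρ with <-cmp a (off + size l)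
... | tri< _ _ _ = refl
... | tri≈ a≮ρ _ _ = ⊥-elim (a≮ρ a<ρ)
... | tri> a≮ρ _ _ = ⊥-elim (a≮ρ a<ρ)

rightmost-root : ∀ {off l r a} → a ≡ off + size l →
                 rightmost off (node l r) a ≡ a + size r
rightmost-root {off} {l} {r} {a} a≡ρ with <-cmp a (off + size l)
... | tri< _ a≢ρ _ = ⊥-elim (a≢ρ a≡ρ)
... | tri≈ _ _ _ = refl
... | tri> _ a≢ρ _ = ⊥-elim (a≢ρ a≡ρ)

rightmost-right : ∀ {off l r a} → off + size l < a →
                  rightmost off (node l r) a ≡ rightmost (suc (off + size l)) r a
rightmost-right {off} {l} {r} {a} ρ<a with <-cmp a (off + size l)
... | tri< _ _ ρ≮a = ⊥-elim (ρ≮a ρ<a)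
... | tri≈ _ _ ρ≮a = ⊥-elim (ρ≮a ρ<a)
... | tri> _ _ _ = refl

right-end : ∀ off sl sr → suc (off + sl) + sr ≡ off + suc (sl + sr)
right-end off sl sr = trans (cong suc (+-assoc off sl sr)) (sym (+-suc off (sl + sr)))

root<end : ∀ off sl sr → off + sl < off + suc (sl + sr)
root<end off sl sr = ≤-trans (s≤s (m≤m+n (off + sl) sr)) (≤-reflexive (right-end off sl sr))

rightmost-≥ : ∀ off t a → a ≤ rightmost off t a
rightmost-≥ off leaf a = ≤-refl
rightmost-≥ off (node l r) a with <-cmp a (off + size l)
... | tri< _ _ _ = rightmost-≥ off l a
... | tri≈ _ _ _ = m≤m+n a (size r)
... | tri> _ _ _ = rightmost-≥ (suc (off + size l)) r a

rightmost-< : ∀ off t a → a < off + size t → rightmost off t a < off + size t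
rightmost-< off leaf a a<end = a<end
rightmost-< off (node l r) a a<end with <-cmp a (off + size l)
... | tri< a<ρ _ _ = <-trans (rightmost-< off l a a<ρ) (root<end off (size l) (size r))
... | tri≈ _ refl _ = ≤-reflexive (right-end off (size l) (size r))
... | tri> _ _ _ =
  subst (rightmost (suc (off + size l)) r a <_) (right-end off (size l) (size r))
    (rightmost-< (suc (off + size l)) r a
      (subst (a <_) (sym (right-end off (size l) (size r))) a<end))

rightmost-nested : ∀ off t a c → a < c → c ≤ rightmost off t a →
                   rightmost off t c ≤ rightmost off t a
rightmost-nested off leaf a c a<c c≤a = ⊥-elim (<-irrefl refl (<-≤-trans a<c c≤a))
rightmost-nested off (node l r) a c a<c c≤ with <-cmp a (off + size l)
... | tri< a<ρ _ _ =
  subst (_≤ rightmost off l a)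
    (sym (rightmost-left (≤-<-trans c≤ (rightmost-< off l a a<ρ))))
    (rightmost-nested off l a c a<c c≤)
... | tri≈ _ refl _ =
  subst (_≤ off + size l + size r) (sym (rightmost-right a<c))
    (<⇒≤pred (rightmost-< (suc (off + size l)) r c (s≤s c≤)))
... | tri> _ _ ρ<a =
  subst (_≤ rightmost (suc (off + size l)) r a) (sym (rightmost-right (<-trans ρ<a a<c)))
    (rightmost-nested (suc (off + size l)) r a c a<c c≤)

-- If the root of (node l r) is a label of the smaller tree l′, the right ends
-- at that label differ: it is a root in one tree but not in the other.
split-root-differs : ∀ off l r l′ r′ → size l + size r ≡ size l′ + size r′ →
  size l < size l′ →
  rightmost off (node l r) (off + size l) ≢ rightmost off (node l′ r′) (off + size l)
split-root-differs off l r l′ r′ same-size l<l′ same-end =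
  <-irrefl refl (<-≤-trans end-in-l′ l′-before-end)
  where
  ρ<ρ′ : off + size l < off + size l′
  ρ<ρ′ = +-monoʳ-< off l<l′
  end-in-l′ : off + size l + size r < off + size l′
  end-in-l′ =
    subst (_< off + size l′)
      (trans (sym (rightmost-left {off} {l′} {r′} ρ<ρ′))
        (trans (sym same-end) (rightmost-root {off} {l} {r} refl)))
      (rightmost-< off l′ (off + size l) ρ<ρ′)
  l′-before-end : off + size l′ ≤ off + size l + size r
  l′-before-end =
    ≤-trans (+-monoʳ-≤ off (m≤m+n (size l′) (size r′)))
      (≤-reflexive (trans (cong (off +_) (sym same-size)) (sym (+-assoc off (size l) (size r)))))

rightmost-injective : ∀ off s t → size s ≡ size t →
  (∀ a → off ≤ a → a < off + size s → rightmost off s a ≡ rightmost off t a) → s ≡ t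
rightmost-injective off leaf leaf _ _ = refl
rightmost-injective off (node l r) (node l′ r′) same-size same-ends
  with <-cmp (size l) (size l′)
... | tri< l<l′ _ _ =
  ⊥-elim (split-root-differs off l r l′ r′ (suc-injective same-size) l<l′
    (same-ends (off + size l) (m≤m+n off (size l)) (root<end off (size l) (size r))))
... | tri> _ _ l′<l =
  ⊥-elim (split-root-differs off l′ r′ l r (sym (suc-injective same-size)) l′<l
    (sym (same-ends (off + size l′) (m≤m+n off (size l′))
      (<-trans (+-monoʳ-< off l′<l) (root<end off (size l) (size r))))))
... | tri≈ _ same-l-size _ = cong₂ node same-l same-r
  where
  same-r-size : size r ≡ size r′
  same-r-size = +-cancelˡ-≡ (size l) (size r) (size r′)
    (trans (suc-injective same-size) (cong (_+ size r′) (sym same-l-size)))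
  same-l : l ≡ l′
  same-l = rightmost-injective off l l′ same-l-size λ a off≤a a<ρ →
    trans (sym (rightmost-left {off} {l} {r} a<ρ))
      (trans (same-ends a off≤a (<-trans a<ρ (root<end off (size l) (size r))))
        (rightmost-left {off} {l′} {r′} (subst (λ m → a < off + m) same-l-size a<ρ)))
  same-r : r ≡ r′
  same-r = rightmost-injective (suc (off + size l)) r r′ same-r-size λ a ρ<a a<end →
    trans (sym (rightmost-right {off} {l} {r} ρ<a))
      (trans (same-ends a (≤-trans (m≤m+n off (size l)) (<⇒≤ ρ<a))
                (subst (a <_) (right-end off (size l) (size r)) a<end))
        (trans (rightmost-right {off} {l′} {r′} (subst (λ m → off + m < a) same-l-size ρ<a))
          (cong (λ m → rightmost (suc (off + m)) r′ a) (sym same-l-size))))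

inLeft-lower : ∀ {off t a k} → InLeft off t a k → off ≤ a
inLeft-lower (here _ off≤a _) = off≤a
inLeft-lower (inL p) = inLeft-lower p
inLeft-lower {off} {node l r} (inR p) = ≤-trans (m≤m+n off (size l)) (<⇒≤ (inLeft-lower p))

inLeft-< : ∀ {off t a k} → InLeft off t a k → a < k
inLeft-< (here _ _ a<k) = a<k
inLeft-< (inL p) = inLeft-< p
inLeft-< (inR p) = inLeft-< p

inLeft-upper : ∀ {off t a k} → InLeft off t a k → k < off + size t
inLeft-upper {off} {node l r} (here refl _ _) = root<end off (size l) (size r)
inLeft-upper {off} {node l r} (inL p) = <-trans (inLeft-upper p) (root<end off (size l) (size r))
inLeft-upper {off} {node l r} {k = k} (inR p) =
  subst (k <_) (right-end off (size l) (size r)) (inLeft-upper p)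

inLeft⇒rightmost< : ∀ {off t a k} → InLeft off t a k → rightmost off t a < k
inLeft⇒rightmost< {off} {node l r} {a} (here refl _ a<ρ) =
  subst (_< off + size l) (sym (rightmost-left a<ρ)) (rightmost-< off l a a<ρ)
inLeft⇒rightmost< {off} {node l r} (inL p) =
  subst (_< _) (sym (rightmost-left (<-trans (inLeft-< p) (inLeft-upper p)))) (inLeft⇒rightmost< p)
inLeft⇒rightmost< {off} {node l r} (inR p) =
  subst (_< _) (sym (rightmost-right (inLeft-lower p))) (inLeft⇒rightmost< p)

inLeft-next : ∀ off t a → off ≤ a → suc (rightmost off t a) < off + size t →
              InLeft off t a (suc (rightmost off t a))
inLeft-next off leaf a off≤a next<end =
  ⊥-elim (<-irrefl refl (≤-<-trans off≤a
    (<-trans (n<1+n a) (subst (suc a <_) (+-identityʳ off) next<end))))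
inLeft-next off (node l r) a off≤a next<end with <-cmp a (off + size l)
... | tri< a<ρ _ _ with m≤n⇒m<n∨m≡n (rightmost-< off l a a<ρ)
...   | inj₁ next<ρ = inL (inLeft-next off l a off≤a next<ρ)
...   | inj₂ next≡ρ = here next≡ρ off≤a (s≤s (rightmost-≥ off l a))
inLeft-next off (node l r) a off≤a next<end | tri≈ _ refl _ =
  ⊥-elim (<-irrefl (right-end off (size l) (size r)) next<end)
inLeft-next off (node l r) a off≤a next<end | tri> _ _ ρ<a =
  inR (inLeft-next (suc (off + size l)) r a ρ<a
    (subst (suc (rightmost (suc (off + size l)) r a) <_)
      (sym (right-end off (size l) (size r))) next<end))

inRight-lower : ∀ {off t a b} → InRight off t a b → off ≤ a
inRight-lower {off} {node l r} (here refl _ _) = m≤m+n off (size l)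
inRight-lower (inL p) = inRight-lower p
inRight-lower {off} {node l r} (inR p) = ≤-trans (m≤m+n off (size l)) (<⇒≤ (inRight-lower p))

inRight-upper : ∀ {off t a b} → InRight off t a b → a < off + size t
inRight-upper {off} {node l r} (here refl _ _) = root<end off (size l) (size r)
inRight-upper {off} {node l r} (inL p) = <-trans (inRight-upper p) (root<end off (size l) (size r))
inRight-upper {off} {node l r} {a} (inR p) =
  subst (a <_) (right-end off (size l) (size r)) (inRight-upper p)

inRight⇒≤rightmost : ∀ {off t a b} → InRight off t a b → b ≤ rightmost off t a
inRight⇒≤rightmost {off} {node l r} (here refl _ b≤) =
  subst (_ ≤_) (sym (rightmost-root {off} {l} {r} refl)) b≤
inRight⇒≤rightmost (inL p) = subst (_ ≤_) (sym (rightmost-left (inRight-upper p))) (inRight⇒≤rightmost p)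
inRight⇒≤rightmost (inR p) = subst (_ ≤_) (sym (rightmost-right (inRight-lower p))) (inRight⇒≤rightmost p)

≤rightmost⇒inRight : ∀ off t a b → a < b → b ≤ rightmost off t a → InRight off t a b
≤rightmost⇒inRight off leaf a b a<b b≤a = ⊥-elim (<-irrefl refl (<-≤-trans a<b b≤a))
≤rightmost⇒inRight off (node l r) a b a<b b≤ with <-cmp a (off + size l)
... | tri< _ _ _ = inL (≤rightmost⇒inRight off l a b a<b b≤)
... | tri≈ _ a≡ρ _ = here a≡ρ a<b b≤
... | tri> _ _ _ = inR (≤rightmost⇒inRight _ r a b a<b b≤)

-- Right rotations.  The pivot of a rotation  y(x(A,B),C) → x(A,y(B,C))  is
-- the label x; only the right end of the pivot changes, and it becomes the
-- right end of y = (old right end of x) + 1.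

rotation-size : ∀ {s t} → s ⟶ t → size s ≡ size t
rotation-size (rot {A} {B} {C}) =
  cong suc (trans (cong (_+ size C) (sym (+-suc (size A) (size B))))
                  (+-assoc (size A) (suc (size B)) (size C)))
rotation-size (left {r = r} p) = cong (λ m → suc (m + size r)) (rotation-size p)
rotation-size (right {l} p) = cong (λ m → suc (size l + m)) (rotation-size p)

≤T-size : ∀ {s t} → s ≤T t → size s ≡ size t
≤T-size ε = refl
≤T-size (p ◅ q) = trans (rotation-size p) (≤T-size q)

pivot : ℕ → ∀ {s t} → s ⟶ t → ℕ
pivot off (rot {A}) = off + size A
pivot off (left p) = pivot off p
pivot off (right {l} p) = pivot (suc (off + size l)) p

module RootRotation (off : ℕ) (A B C : Tree) where
  S S′ : Tree
  S = node (node A B) C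
  S′ = node A (node B C)

  x y : ℕ
  x = off + size A
  y = suc (off + size A + size B)

  y≡root : y ≡ off + size (node A B)
  y≡root = right-end off (size A) (size B)

  before-x : rightmost off S x ≡ off + size A + size B
  before-x = trans (rightmost-left {off} {node A B} {C} (root<end off (size A) (size B)))
                   (rightmost-root {off} {A} {B} refl)

  before-y : rightmost off S y ≡ y + size C
  before-y = rightmost-root {off} {node A B} {C} y≡root

  after-x : rightmost off S′ x ≡ y + size C
  after-x = begin
    rightmost off S′ x               ≡⟨ rightmost-root {off} {A} {node B C} refl ⟩
    x + suc (size B + size C)        ≡⟨ +-suc x (size B + size C) ⟩
    suc (x + (size B + size C))      ≡⟨ cong suc (sym (+-assoc x (size B) (size C))) ⟩
    y + size C                       ∎
    where open ≡-Reasoning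

  next-in-S : suc (rightmost off S x) < off + size S
  next-in-S = subst (λ m → suc m < off + size S) (sym before-x)
                (subst (_< off + size S) (sym y≡root) (root<end off (size (node A B)) (size C)))

  at-pivot : rightmost off S′ x ≡ rightmost off S (suc (rightmost off S x))
  at-pivot = trans after-x (sym (trans (cong (λ m → rightmost off S (suc m)) before-x) before-y))

  off-pivot : ∀ z → z ≢ x → rightmost off S′ z ≡ rightmost off S z
  off-pivot z z≢x = by-position (<-cmp z x)
    where
    right-of-x : x < z → Tri (z < y) (z ≡ y) (y < z) →
                 rightmost (suc x) (node B C) z ≡ rightmost off S z
    right-of-x x<z (tri< z<y _ _) =
      trans (rightmost-left {suc x} {B} {C} z<y)
        (sym (trans (rightmost-left {off} {node A B} {C} (subst (z <_) y≡root z<y))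
                    (rightmost-right {off} {A} {B} x<z)))
    right-of-x x<z (tri≈ _ z≡y _) =
      trans (rightmost-root {suc x} {B} {C} z≡y)
        (sym (rightmost-root {off} {node A B} {C} (trans z≡y y≡root)))
    right-of-x x<z (tri> _ _ y<z) =
      trans (rightmost-right {suc x} {B} {C} y<z)
        (sym (trans (rightmost-right {off} {node A B} {C} (subst (_< z) y≡root y<z))
                    (cong (λ o → rightmost (suc o) C z) (sym y≡root))))
    by-position : Tri (z < x) (z ≡ x) (x < z) → rightmost off S′ z ≡ rightmost off S z
    by-position (tri< z<x _ _) =
      trans (rightmost-left {off} {A} {node B C} z<x)
        (sym (trans (rightmost-left {off} {node A B} {C} (<-trans z<x (root<end off (size A) (size B))))
                    (rightmost-left {off} {A} {B} z<x)))
    by-position (tri≈ _ z≡x _) = ⊥-elim (z≢x z≡x)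
    by-position (tri> _ _ x<z) =
      trans (rightmost-right {off} {A} {node B C} x<z) (right-of-x x<z (<-cmp z y))

-- The label after the subtree of the pivot exists (it is the old parent y).
pivot-range : ∀ off {s t} (p : s ⟶ t) →
              off ≤ pivot off p × suc (rightmost off s (pivot off p)) < off + size s
rightmost-pivot : ∀ off {s t} (p : s ⟶ t) →
  rightmost off t (pivot off p) ≡ rightmost off s (suc (rightmost off s (pivot off p)))
rightmost-off-pivot : ∀ off {s t} (p : s ⟶ t) z → z ≢ pivot off p →
                      rightmost off t z ≡ rightmost off s z

pivot-range off (rot {A} {B} {C}) = m≤m+n off (size A) , RootRotation.next-in-S off A B C
pivot-range off (left {l} {l′} {r} p) =
  off≤x , subst (λ m → suc m < off + size (node l r)) (sym (rightmost-left {off} {l} {r} x<ρ))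
            (<-trans next<ρ (root<end off (size l) (size r)))
  where
  off≤x : off ≤ pivot off p
  off≤x = proj₁ (pivot-range off p)
  next<ρ : suc (rightmost off l (pivot off p)) < off + size l
  next<ρ = proj₂ (pivot-range off p)
  x<ρ : pivot off p < off + size l
  x<ρ = ≤-<-trans (rightmost-≥ off l (pivot off p)) (<-trans (n<1+n _) next<ρ)
pivot-range off (right {l} {r} p) =
  ≤-trans (m≤m+n off (size l)) (<⇒≤ ρ<x) ,
  subst (λ m → suc m < off + size (node l r)) (sym (rightmost-right {off} {l} {r} ρ<x))
    (subst (suc (rightmost (suc (off + size l)) r x) <_) (right-end off (size l) (size r)) next<end)
  where
  x : ℕ
  x = pivot (suc (off + size l)) p
  ρ<x : off + size l < x
  ρ<x = proj₁ (pivot-range (suc (off + size l)) p)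
  next<end : suc (rightmost (suc (off + size l)) r x) < suc (off + size l) + size r
  next<end = proj₂ (pivot-range (suc (off + size l)) p)

rightmost-pivot off (rot {A} {B} {C}) = RootRotation.at-pivot off A B C
rightmost-pivot off (left {l} {l′} {r} p) =
  trans (rightmost-left {off} {l′} {r} (subst (λ m → x < off + m) (rotation-size p) x<ρ))
    (trans (rightmost-pivot off p)
      (sym (trans (cong (λ m → rightmost off (node l r) (suc m)) (rightmost-left {off} {l} {r} x<ρ))
                  (rightmost-left {off} {l} {r} next<ρ))))
  where
  x : ℕ
  x = pivot off p
  next<ρ : suc (rightmost off l x) < off + size l
  next<ρ = proj₂ (pivot-range off p)
  x<ρ : x < off + size l
  x<ρ = ≤-<-trans (rightmost-≥ off l x) (<-trans (n<1+n _) next<ρ)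
rightmost-pivot off (right {l} {r} {r′} p) =
  trans (rightmost-right {off} {l} {r′} ρ<x)
    (trans (rightmost-pivot (suc (off + size l)) p)
      (sym (trans (cong (λ m → rightmost off (node l r) (suc m)) (rightmost-right {off} {l} {r} ρ<x))
                  (rightmost-right {off} {l} {r} (<-≤-trans ρ<x x≤next)))))
  where
  x : ℕ
  x = pivot (suc (off + size l)) p
  ρ<x : off + size l < x
  ρ<x = proj₁ (pivot-range (suc (off + size l)) p)
  x≤next : x ≤ suc (rightmost (suc (off + size l)) r x)
  x≤next = ≤-trans (rightmost-≥ (suc (off + size l)) r x) (n≤1+n _)

rightmost-off-pivot off (rot {A} {B} {C}) = RootRotation.off-pivot off A B C
rightmost-off-pivot off (left {l} {l′} {r} p) z z≢x = by-position (<-cmp z (off + size l))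
  where
  by-position : Tri (z < off + size l) (z ≡ off + size l) (off + size l < z) →
                rightmost off (node l′ r) z ≡ rightmost off (node l r) z
  by-position (tri< z<ρ _ _) =
    trans (rightmost-left {off} {l′} {r} (subst (λ m → z < off + m) (rotation-size p) z<ρ))
      (trans (rightmost-off-pivot off p z z≢x) (sym (rightmost-left {off} {l} {r} z<ρ)))
  by-position (tri≈ _ z≡ρ _) =
    trans (rightmost-root {off} {l′} {r} (trans z≡ρ (cong (off +_) (rotation-size p))))
      (sym (rightmost-root {off} {l} {r} z≡ρ))
  by-position (tri> _ _ ρ<z) =
    trans (rightmost-right {off} {l′} {r} (subst (λ m → off + m < z) (rotation-size p) ρ<z))
      (trans (cong (λ m → rightmost (suc (off + m)) r z) (sym (rotation-size p)))
             (sym (rightmost-right {off} {l} {r} ρ<z)))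
rightmost-off-pivot off (right {l} {r} {r′} p) z z≢x = by-position (<-cmp z (off + size l))
  where
  by-position : Tri (z < off + size l) (z ≡ off + size l) (off + size l < z) →
                rightmost off (node l r′) z ≡ rightmost off (node l r) z
  by-position (tri< z<ρ _ _) =
    trans (rightmost-left {off} {l} {r′} z<ρ) (sym (rightmost-left {off} {l} {r} z<ρ))
  by-position (tri≈ _ z≡ρ _) =
    trans (rightmost-root {off} {l} {r′} z≡ρ)
      (trans (cong (z +_) (sym (rotation-size p))) (sym (rightmost-root {off} {l} {r} z≡ρ)))
  by-position (tri> _ _ ρ<z) =
    trans (rightmost-right {off} {l} {r′} ρ<z)
      (trans (rightmost-off-pivot _ p z z≢x) (sym (rightmost-right {off} {l} {r} ρ<z)))

rotation-monotone : ∀ off {s t} (p : s ⟶ t) z → rightmost off s z ≤ rightmost off t z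
rotation-monotone off {s} p z with z ≟ pivot off p
... | yes refl = subst (rightmost off s z ≤_) (sym (rightmost-pivot off p))
                   (≤-trans (n≤1+n _) (rightmost-≥ off s (suc (rightmost off s z))))
... | no z≢x = ≤-reflexive (sym (rightmost-off-pivot off p z z≢x))

≤T-monotone : ∀ off {s t} → s ≤T t → ∀ z → rightmost off s z ≤ rightmost off t z
≤T-monotone off ε z = ≤-refl
≤T-monotone off (p ◅ q) z = ≤-trans (rotation-monotone off p z) (≤T-monotone off q z)

-- For a label x0 whose subtree is followed by another
-- label, rotate at the smallest label x sharing x0's right end: x is the left
-- child of the label right after that right end.

GoodRotation : ℕ → Tree → ℕ → Set
GoodRotation off t x0 = Σ Tree λ t′ → Σ (t ⟶ t′) λ p →
  pivot off p ≤ x0 × rightmost off t (pivot off p) ≡ rightmost off t x0 ×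
  (∀ a → off ≤ a → a < pivot off p → rightmost off t a ≢ rightmost off t (pivot off p))

goodRotation-inLeft : ∀ {off l r x0} → x0 < off + size l →
  GoodRotation off l x0 → GoodRotation off (node l r) x0
goodRotation-inLeft {off} {l} {r} {x0} x0<ρ (l′ , p , x≤x0 , same-end , smallest) =
  node l′ r , left p , x≤x0 , same-end′ , smallest′
  where
  x : ℕ
  x = pivot off p
  x<ρ : x < off + size l
  x<ρ = ≤-<-trans (rightmost-≥ off l x) (<-trans (n<1+n _) (proj₂ (pivot-range off p)))
  same-end′ : rightmost off (node l r) x ≡ rightmost off (node l r) x0
  same-end′ = trans (rightmost-left {off} {l} {r} x<ρ)
                (trans same-end (sym (rightmost-left {off} {l} {r} x0<ρ)))
  smallest′ : ∀ a → off ≤ a → a < x → rightmost off (node l r) a ≢ rightmost off (node l r) x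
  smallest′ a off≤a a<x e = smallest a off≤a a<x
    (trans (sym (rightmost-left {off} {l} {r} (<-trans a<x x<ρ)))
      (trans e (rightmost-left {off} {l} {r} x<ρ)))

-- x0 lies in the right subtree; labels up to the root cannot share its right end.
goodRotation-inRight : ∀ {off l r x0} → off + size l < x0 →
  GoodRotation (suc (off + size l)) r x0 → GoodRotation off (node l r) x0
goodRotation-inRight {off} {l} {r} {x0} ρ<x0 (r′ , p , x≤x0 , same-end , smallest) =
  node l r′ , right p , x≤x0 , same-end′ , smallest′
  where
  ρ x : ℕ
  ρ = off + size l
  x = pivot (suc ρ) p
  t : Tree
  t = node l r
  ρ<x : ρ < x
  ρ<x = proj₁ (pivot-range (suc ρ) p)
  end-x : rightmost off t x ≡ rightmost (suc ρ) r x
  end-x = rightmost-right {off} {l} {r} ρ<x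
  same-end′ : rightmost off t x ≡ rightmost off t x0
  same-end′ = trans end-x (trans same-end (sym (rightmost-right {off} {l} {r} ρ<x0)))
  by-position : ∀ a → rightmost off t a ≡ rightmost off t x → a < x →
                Tri (a < ρ) (a ≡ ρ) (ρ < a) → ⊥
  by-position a e a<x (tri< a<ρ _ _) =
    <-irrefl refl (<-≤-trans
      (subst (_< ρ) (trans (sym (rightmost-left {off} {l} {r} a<ρ)) (trans e end-x))
        (rightmost-< off l a a<ρ))
      (<⇒≤ (≤-trans ρ<x (rightmost-≥ (suc ρ) r x))))
  by-position a e a<x (tri≈ _ a≡ρ _) =
    <-irrefl (trans (sym (trans (sym (rightmost-root {off} {l} {r} a≡ρ)) (trans e end-x)))
                    (cong (_+ size r) a≡ρ))
      (<⇒≤pred (proj₂ (pivot-range (suc ρ) p)))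
  by-position a e a<x (tri> _ _ ρ<a) =
    smallest a ρ<a a<x (trans (sym (rightmost-right {off} {l} {r} ρ<a)) (trans e end-x))
  smallest′ : ∀ a → off ≤ a → a < x → rightmost off t a ≢ rightmost off t x
  smallest′ a _ a<x e = by-position a e a<x (<-cmp a ρ)

-- The subtree of x0 ends just before the root, so x0 lies in the left child
-- l = (A,B): rotate at the root; its pivot off + |A| has the right end of x0.
goodRotation-atRoot : ∀ {off l r x0} → off ≤ x0 → x0 < off + size l →
  suc (rightmost off l x0) ≡ off + size l → GoodRotation off (node l r) x0
goodRotation-atRoot {off} {leaf} {r} {x0} off≤x0 x0<ρ next≡ρ =
  ⊥-elim (<-irrefl refl (≤-<-trans off≤x0 (subst (x0 <_) (+-identityʳ off) x0<ρ)))
goodRotation-atRoot {off} {node A B} {r} {x0} off≤x0 x0<ρ next≡ρ =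
  node A (node B r) , rot , x≤x0 , same-end , smallest
  where
  open RootRotation off A B r using (S; x; before-x)
  end-x0 : rightmost off S x0 ≡ off + size A + size B
  end-x0 = trans (rightmost-left {off} {node A B} {r} x0<ρ)
             (suc-injective (trans next≡ρ (sym (right-end off (size A) (size B)))))
  -- a label of A ends strictly before x = off + |A|, so it cannot share that end
  ends-in-A : ∀ a → a < x → rightmost off S a < off + size A + size B
  ends-in-A a a<x =
    <-≤-trans
      (subst (_< x) (sym (trans (rightmost-left {off} {node A B} {r} (<-trans a<x (root<end off (size A) (size B))))
                                (rightmost-left {off} {A} {B} a<x)))
        (rightmost-< off A a a<x))
      (m≤m+n x (size B))
  x≤x0 : x ≤ x0
  x≤x0 with x0 <? x
  ... | no x0≮x = ≮⇒≥ x0≮x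
  ... | yes x0<x = ⊥-elim (<-irrefl end-x0 (ends-in-A x0 x0<x))
  same-end : rightmost off S x ≡ rightmost off S x0
  same-end = trans before-x (sym end-x0)
  smallest : ∀ a → off ≤ a → a < x →
             rightmost off S a ≢ rightmost off S x
  smallest a _ a<x e = <-irrefl (trans e before-x) (ends-in-A a a<x)

goodRotation : ∀ off t x0 → off ≤ x0 → suc (rightmost off t x0) < off + size t →
               GoodRotation off t x0
goodRotation off leaf x0 off≤x0 next<end =
  ⊥-elim (<-irrefl refl (≤-<-trans off≤x0 (<-trans (≤-<-trans (rightmost-≥ off leaf x0) (n<1+n _))
    (subst (suc x0 <_) (+-identityʳ off) next<end))))
goodRotation off (node l r) x0 off≤x0 next<end = by-position (<-cmp x0 (off + size l))
  where
  ρ : ℕ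
  ρ = off + size l
  inLeft : x0 < ρ → (suc (rightmost off l x0) < ρ) ⊎ (suc (rightmost off l x0) ≡ ρ) →
           GoodRotation off (node l r) x0
  inLeft x0<ρ (inj₁ next<ρ) = goodRotation-inLeft x0<ρ (goodRotation off l x0 off≤x0 next<ρ)
  inLeft x0<ρ (inj₂ next≡ρ) = goodRotation-atRoot off≤x0 x0<ρ next≡ρ
  by-position : Tri (x0 < ρ) (x0 ≡ ρ) (ρ < x0) → GoodRotation off (node l r) x0
  by-position (tri< x0<ρ _ _) = inLeft x0<ρ (m≤n⇒m<n∨m≡n (rightmost-< off l x0 x0<ρ))
  by-position (tri≈ _ x0≡ρ _) =
    ⊥-elim (<-irrefl (right-end off (size l) (size r))
      (subst (λ m → suc m < off + size (node l r))
        (trans (rightmost-root {off} {l} {r} x0≡ρ) (cong (_+ size r) x0≡ρ)) next<end))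
  by-position (tri> _ _ ρ<x0) =
    goodRotation-inRight ρ<x0 (goodRotation (suc ρ) r x0 ρ<x0
      (subst (_< suc ρ + size r) (cong suc (rightmost-right {off} {l} {r} ρ<x0))
        (subst (suc (rightmost off (node l r) x0) <_) (sym (right-end off (size l) (size r))) next<end)))

Inversion : (ℕ → ℕ) → (ℕ → ℕ) → ℕ → ℕ → Set
Inversion g f a b = a < b × b ≤ f a × (∀ {k} → k < b → a ≤ k → g k < b)

inversion? : ∀ g f a b → Dec (Inversion g f a b)
inversion? g f a b = a <? b ×-dec b ≤? f a ×-dec allUpTo? (λ k → a ≤? k →-dec g k <? b) b

no-self-inversion : ∀ f a b → ¬ Inversion f f a b
no-self-inversion f a b (a<b , b≤fa , before-b) = <-irrefl refl (<-≤-trans (before-b a<b ≤-refl) b≤fa)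

InversionPair : ∀ {n} → (ℕ → ℕ) → (ℕ → ℕ) → Fin n × Fin n → Set
InversionPair g f (a , b) = Inversion g f (toℕ a) (toℕ b)

inversionPair? : ∀ {n} g f (p : Fin n × Fin n) → Dec (InversionPair g f p)
inversionPair? g f (a , b) = inversion? g f (toℕ a) (toℕ b)

pairs : ∀ n → List (Fin n × Fin n)
pairs n = cartesianProduct (allFin n) (allFin n)

pairs-unique : ∀ n → Unique (pairs n)
pairs-unique n = Unique.cartesianProduct⁺ (Unique.allFin⁺ n) (Unique.allFin⁺ n)

∈-pairs : ∀ n (p : Fin n × Fin n) → p ∈ pairs n
∈-pairs n (a , b) = ∈-cartesianProduct⁺ (∈-allFin a) (∈-allFin b)

inversionCount : ℕ → (ℕ → ℕ) → (ℕ → ℕ) → ℕ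
inversionCount n g f = length (filter (inversionPair? {n} g f) (pairs n))

module FilterLength {A : Set} {P P′ : A → Set} (P? : ∀ x → Dec (P x)) (P′? : ∀ x → Dec (P′ x))
                    (P′⊆P : ∀ x → P′ x → P x) where

  mono : ∀ xs → length (filter P′? xs) ≤ length (filter P? xs)
  mono [] = z≤n
  mono (x ∷ xs) with P′? x | P? x
  ... | yes _ | yes _ = s≤s (mono xs)
  ... | yes p′ | no ¬p = ⊥-elim (¬p (P′⊆P x p′))
  ... | no _ | yes _ = ≤-trans (mono xs) (n≤1+n _)
  ... | no _ | no _ = mono xs

  strict : ∀ xs {w} → w ∈ xs → P w → ¬ P′ w → length (filter P′? xs) < length (filter P? xs)
  strict (x ∷ xs) (here refl) pw ¬p′w with P′? x | P? x
  ... | yes p′ | _ = ⊥-elim (¬p′w p′)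
  ... | no _ | yes _ = s≤s (mono xs)
  ... | no _ | no ¬p = ⊥-elim (¬p pw)
  strict (x ∷ xs) (there w∈xs) pw ¬p′w with P′? x | P? x
  ... | yes _ | yes _ = s≤s (strict xs w∈xs pw ¬p′w)
  ... | yes p′ | no ¬p = ⊥-elim (¬p (P′⊆P x p′))
  ... | no _ | yes _ = <-trans (strict xs w∈xs pw ¬p′w) (n<1+n _)
  ... | no _ | no _ = strict xs w∈xs pw ¬p′w

  same : ∀ xs → (∀ x → x ∈ xs → P x → P′ x) → length (filter P′? xs) ≡ length (filter P? xs)
  same [] _ = refl
  same (x ∷ xs) P⊆P′ with P′? x | P? x
  ... | yes _ | yes _ = cong suc (same xs (λ z m → P⊆P′ z (there m)))
  ... | yes p′ | no ¬p = ⊥-elim (¬p (P′⊆P x p′))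
  ... | no ¬p′ | yes p = ⊥-elim (¬p′ (P⊆P′ x (here refl) p))
  ... | no _ | no _ = same xs (λ z m → P⊆P′ z (there m))

  one-more : ∀ xs {w} → Unique xs → w ∈ xs → P w → ¬ P′ w →
             (∀ x → P x → ¬ P′ x → x ≡ w) →
             length (filter P? xs) ≡ suc (length (filter P′? xs))
  one-more (x ∷ xs) (x∉xs AllPairs.∷ _) (here refl) pw ¬p′w only-w with P′? x | P? x
  ... | yes p′ | _ = ⊥-elim (¬p′w p′)
  ... | no _ | no ¬p = ⊥-elim (¬p pw)
  ... | no _ | yes _ = cong suc (sym (same xs (λ z m pz → rest z m pz (P′? z))))
    where
    rest : ∀ z → z ∈ xs → P z → Dec (P′ z) → P′ z
    rest z m pz (yes p′z) = p′z
    rest z m pz (no ¬p′z) = ⊥-elim (All.lookup x∉xs m (sym (only-w z pz ¬p′z)))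
  one-more (x ∷ xs) (x∉xs AllPairs.∷ u) (there w∈xs) pw ¬p′w only-w with P′? x | P? x
  ... | yes _ | yes _ = cong suc (one-more xs u w∈xs pw ¬p′w only-w)
  ... | yes p′ | no ¬p = ⊥-elim (¬p (P′⊆P x p′))
  ... | no ¬p′ | yes p = ⊥-elim (All.lookup x∉xs w∈xs (only-w x p ¬p′))
  ... | no _ | no _ = one-more xs u w∈xs pw ¬p′w only-w

SmallestGap : (ℕ → ℕ) → (ℕ → ℕ) → ℕ → Set
SmallestGap g f n =
  Σ ℕ λ x0 → x0 < n × g x0 < f x0 × (∀ a → a < n → g a < f a → g x0 ≤ g a)

smallestGap : ∀ g f n → (∀ a → a < n → ¬ g a < f a) ⊎ SmallestGap g f n
smallestGap g f n with filter (λ a → g a <? f a) (upTo n) in gaps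
... | [] = inj₁ λ a a<n gap → absurd (subst (a ∈_) gaps (∈-filter⁺ (λ a → g a <? f a) (∈-upTo⁺ a<n) gap))
  where
  absurd : ∀ {a} → a ∈ [] → ⊥
  absurd ()
... | c ∷ cs = inj₂ (argmin g c cs , proj₁ x0-gap , proj₂ x0-gap , minimal)
  where
  gap : ∀ {a} → a ∈ c ∷ cs → a < n × g a < f a
  gap m with ∈-filter⁻ (λ a → g a <? f a) (subst (_ ∈_) (sym gaps) m)
  ... | a∈upTo , lt = ∈-upTo⁻ a∈upTo , lt
  x0-gap : argmin g c cs < n × g (argmin g c cs) < f (argmin g c cs)
  x0-gap with All.tabulate {xs = c ∷ cs} gap
  ... | gap-c ∷ gap-cs = argmin-all g gap-c gap-cs
  minimal : ∀ a → a < n → g a < f a → g (argmin g c cs) ≤ g a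
  minimal a a<n lt =
    All.lookup (f[argmin]≤f[⊤] {f = g} c cs ∷ f[argmin]≤f[xs] {f = g} c cs)
      (subst (a ∈_) gaps (∈-filter⁺ (λ a → g a <? f a) (∈-upTo⁺ a<n) lt))

-- Stated for abstract vectors:
-- g is the right-end vector before the rotation, g′ after it, x the pivot,
-- f the upper vector (only g′ x ≤ f x is needed).

module OneRotation (g g′ f : ℕ → ℕ) (x : ℕ)
  (at-pivot : g′ x ≡ g (suc (g x)))
  (off-pivot : ∀ z → z ≢ x → g′ z ≡ g z)
  (g-≥ : ∀ z → z ≤ g z)
  (g-nested : ∀ a c → a < c → c ≤ g a → g c ≤ g a)
  (pivot-below : g′ x ≤ f x) where

  y : ℕ
  y = suc (g x)

  y≤g′x : y ≤ g′ x
  y≤g′x = subst (y ≤_) (sym at-pivot) (g-≥ y)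

  g≤g′ : ∀ z → g z ≤ g′ z
  g≤g′ z with z ≟ x
  ... | yes refl = ≤-trans (n≤1+n _) y≤g′x
  ... | no z≢x = ≤-reflexive (sym (off-pivot z z≢x))

  no-new-inversion : ∀ a b → Inversion g′ f a b → Inversion g f a b
  no-new-inversion a b (a<b , b≤fa , before-b) =
    a<b , b≤fa , λ k<b a≤k → ≤-<-trans (g≤g′ _) (before-b k<b a≤k)

  inversion-before : Inversion g f x y
  inversion-before = s≤s (g-≥ x) , ≤-trans y≤g′x pivot-below , before-y
    where
    before-y : ∀ {k} → k < y → x ≤ k → g k < y
    before-y {k} k<y x≤k with m≤n⇒m<n∨m≡n x≤k
    ... | inj₁ x<k = s≤s (g-nested x k x<k (<⇒≤pred k<y))
    ... | inj₂ refl = ≤-refl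

  no-inversion-after : ¬ Inversion g′ f x y
  no-inversion-after (_ , _ , before-y) = <-irrefl refl (<-≤-trans (before-y (s≤s (g-≥ x)) ≤-refl) y≤g′x)

  -- A destroyed inversion (a , b) needs a ≤ x < b and g′ x ≥ b; since the
  -- label y ≤ b itself lies in [a , b), it must be b.
  destroyed : ∀ a b → Inversion g f a b → ¬ Inversion g′ f a b → b ≡ y × a ≤ x
  destroyed a b (a<b , b≤fa , before-b) not-after = by-cases (a ≤? x) (x <? b) (g′ x <? b)
    where
    survives : (a ≤ x → x < b → g′ x < b) → ⊥
    survives pivot-ok = not-after (a<b , b≤fa , λ {k} k<b a≤k → at k k<b a≤k (k ≟ x))
      where
      at : ∀ k → k < b → a ≤ k → Dec (k ≡ x) → g′ k < b
      at k k<b a≤k (yes refl) = pivot-ok a≤k k<b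
      at k k<b a≤k (no k≢x) = subst (_< b) (sym (off-pivot k k≢x)) (before-b k<b a≤k)
    by-cases : Dec (a ≤ x) → Dec (x < b) → Dec (g′ x < b) → b ≡ y × a ≤ x
    by-cases (no a≰x) _ _ = ⊥-elim (survives λ a≤x _ → ⊥-elim (a≰x a≤x))
    by-cases (yes _) (no x≮b) _ = ⊥-elim (survives λ _ x<b → ⊥-elim (x≮b x<b))
    by-cases (yes _) (yes _) (yes g′x<b) = ⊥-elim (survives λ _ _ → g′x<b)
    by-cases (yes a≤x) (yes x<b) (no g′x≮b) = ≤-antisym b≤y y≤b , a≤x
      where
      y≤b : y ≤ b
      y≤b = before-b x<b a≤x
      b≤y : b ≤ y
      b≤y = ≮⇒≥ λ y<b → <-irrefl refl
        (<-≤-trans (before-b y<b (≤-trans a≤x (≤-trans (g-≥ x) (n≤1+n _))))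
                   (≤-trans (≮⇒≥ g′x≮b) (≤-reflexive at-pivot)))

chain⇒≤T : ∀ {S T k} → Chain S T k → S ≤T T
chain⇒≤T done = ε
chain⇒≤T (step (S≤U , _) c) = S≤U ◅◅ chain⇒≤T c

module Distance (n : ℕ) (T₂ : Tree) (size-T₂ : size T₂ ≡ n) where

  f : ℕ → ℕ
  f = rightmost 0 T₂

  inv : Tree → ℕ
  inv S = inversionCount n (rightmost 0 S) f

  Below : Tree → Set
  Below S = ∀ z → rightmost 0 S z ≤ f z

  f<n : ∀ z → z < n → f z < n
  f<n z z<n = subst (f z <_) size-T₂ (rightmost-< 0 T₂ z (subst (z <_) (sym size-T₂) z<n))

  inv-T₂ : inv T₂ ≡ 0
  inv-T₂ = cong length (filter-none (inversionPair? {n} f f) {pairs n}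
             (All.tabulate λ {(a , b)} _ → no-self-inversion f (toℕ a) (toℕ b)))

  module Step {S S′} (p : S ⟶ S′) (size-S : size S ≡ n) (below : Below S′) where
    g g′ : ℕ → ℕ
    g = rightmost 0 S
    g′ = rightmost 0 S′

    open OneRotation g g′ f (pivot 0 p) (rightmost-pivot 0 p) (rightmost-off-pivot 0 p)
      (rightmost-≥ 0 S) (rightmost-nested 0 S) (below (pivot 0 p)) public

    y<n : y < n
    y<n = subst (y <_) size-S (proj₂ (pivot-range 0 p))

    x<n : pivot 0 p < n
    x<n = ≤-<-trans (rightmost-≥ 0 S (pivot 0 p)) (<-trans (n<1+n _) y<n)

    pivotPair : Fin n × Fin n
    pivotPair = fromℕ< x<n , fromℕ< y<n

    pivotPair-before : InversionPair g f pivotPair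
    pivotPair-before = subst₂ (Inversion g f) (sym (toℕ-fromℕ< x<n)) (sym (toℕ-fromℕ< y<n)) inversion-before

    pivotPair-after : ¬ InversionPair g′ f pivotPair
    pivotPair-after i = no-inversion-after (subst₂ (Inversion g′ f) (toℕ-fromℕ< x<n) (toℕ-fromℕ< y<n) i)

    open FilterLength (inversionPair? {n} g f) (inversionPair? g′ f)
      (λ (a , b) → no-new-inversion (toℕ a) (toℕ b)) using (strict; one-more) public

    decreases : inv S′ < inv S
    decreases = strict (pairs n) (∈-pairs n pivotPair) pivotPair-before pivotPair-after

  ≤T-decreases : ∀ {S U} → S ≤T U → U ≤T T₂ → size S ≡ n → inv U ≤ inv S
  ≤T-decreases ε _ _ = ≤-refl
  ≤T-decreases (p ◅ q) U≤T₂ size-S =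
    ≤-trans (≤T-decreases q U≤T₂ (trans (sym (rotation-size p)) size-S))
      (<⇒≤ (Step.decreases p size-S (≤T-monotone 0 (q ◅◅ U≤T₂))))

  <T-decreases : ∀ {S U} → S <T U → U ≤T T₂ → size S ≡ n → inv U < inv S
  <T-decreases (ε , S≢S) _ _ = ⊥-elim (S≢S refl)
  <T-decreases (p ◅ q , _) U≤T₂ size-S =
    ≤-<-trans (≤T-decreases q U≤T₂ (trans (sym (rotation-size p)) size-S))
      (Step.decreases p size-S (≤T-monotone 0 (q ◅◅ U≤T₂)))

  -- Upper bound: each step of a chain destroys an inversion.
  chain-bound : ∀ {S} k → Chain S T₂ k → size S ≡ n → k ≤ inv S
  chain-bound zero done _ = z≤n
  chain-bound (suc k) (step S<U c) size-S =
    ≤-trans (s≤s (chain-bound k c size-U)) (<T-decreases S<U (chain⇒≤T c) size-S)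
    where
    size-U : size _ ≡ n
    size-U = trans (sym (≤T-size (proj₁ S<U))) size-S

  -- Rotating at the pivot x sharing the right end of a label x0 with
  -- g x0 < f x0 keeps S below T₂: the new right end g y of x (y = g x + 1)
  -- is at most f y ≤ f x0 ≤ f x, by nesting of subtrees in T₂.
  rotation-stays-below : ∀ {S S′ x0} (p : S ⟶ S′) → Below S →
    rightmost 0 S x0 < f x0 → pivot 0 p ≤ x0 →
    rightmost 0 S (pivot 0 p) ≡ rightmost 0 S x0 → Below S′
  rotation-stays-below {S} {S′} {x0} p below gap-x0 x≤x0 same-end z with z ≟ pivot 0 p
  ... | no z≢x = subst (_≤ f z) (sym (rightmost-off-pivot 0 p z z≢x)) (below z)
  ... | yes refl = subst (_≤ f z) (sym (rightmost-pivot 0 p)) (≤-trans (below y) (≤-trans fy≤fx0 fx0≤fx))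
    where
    y : ℕ
    y = suc (rightmost 0 S z)
    fy≤fx0 : f y ≤ f x0
    fy≤fx0 = rightmost-nested 0 T₂ x0 y (s≤s (≤-trans (rightmost-≥ 0 S x0) (≤-reflexive (sym same-end))))
               (subst (λ m → suc m ≤ f x0) (sym same-end) gap-x0)
    fx0≤fx : f x0 ≤ f z
    fx0≤fx with m≤n⇒m<n∨m≡n x≤x0
    ... | inj₂ x≡x0 = ≤-reflexive (cong f (sym x≡x0))
    ... | inj₁ x<x0 = rightmost-nested 0 T₂ z x0 x<x0
                        (≤-trans (rightmost-≥ 0 S x0) (≤-trans (≤-reflexive (sym same-end)) (below z)))

  -- Below T₂ but not T₂: rotating at the good rotation for the label x0 whose
  -- right end is smallest among those still below f destroys exactly one inversion.
  descend : ∀ S → size S ≡ n → Below S → SmallestGap (rightmost 0 S) f n →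
            Σ Tree λ S′ → (S ⟶ S′) × Below S′ × inv S ≡ suc (inv S′)
  descend S size-S below (x0 , x0<n , gap-x0 , minimal)
    with goodRotation 0 S x0 z≤n
           (subst (suc (rightmost 0 S x0) <_) (sym size-S) (≤-<-trans gap-x0 (f<n x0 x0<n)))
  ... | S′ , p , x≤x0 , same-end , smallest = S′ , p , below′ , exactly-one
    where
    g : ℕ → ℕ
    g = rightmost 0 S
    x y : ℕ
    x = pivot 0 p
    y = suc (g x)
    below′ : Below S′
    below′ = rotation-stays-below p below gap-x0 x≤x0 same-end
    open Step p size-S below′ using (destroyed; pivotPair; pivotPair-before; pivotPair-after; one-more)
    -- a destroyed pair (a , y) with a < x would give a smaller label with x's right end
    only-pivotPair : ∀ q → InversionPair g f q → ¬ InversionPair (rightmost 0 S′) f q → q ≡ pivotPair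
    only-pivotPair (a , b) i not-after with destroyed (toℕ a) (toℕ b) i not-after
    ... | b≡y , a≤x = cong₂ _,_ (toℕ-injective (trans a≡x (sym (toℕ-fromℕ< _))))
                                (toℕ-injective (trans b≡y (sym (toℕ-fromℕ< _))))
      where
      ga<y : g (toℕ a) < y
      ga<y = subst (g (toℕ a) <_) b≡y (proj₂ (proj₂ i) (proj₁ i) ≤-refl)
      a≡x : toℕ a ≡ x
      a≡x with m≤n⇒m<n∨m≡n a≤x
      ... | inj₂ a≡x = a≡x
      ... | inj₁ a<x = ⊥-elim (smallest (toℕ a) z≤n a<x (≤-antisym (<⇒≤pred ga<y)
              (subst (_≤ g (toℕ a)) (sym same-end)
                (minimal (toℕ a) (toℕ<n a) (<-≤-trans ga<y (subst (_≤ f (toℕ a)) b≡y (proj₁ (proj₂ i))))))))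
    exactly-one : inv S ≡ suc (inv S′)
    exactly-one = one-more (pairs n) (pairs-unique n) (∈-pairs n pivotPair)
                    pivotPair-before pivotPair-after only-pivotPair

  -- Lower bound: descending one inversion at a time yields a chain of length inv S.
  chain-exists : ∀ m S → size S ≡ n → Below S → inv S ≡ m → Chain S T₂ m
  chain-exists m S size-S below count with smallestGap (rightmost 0 S) f n
  ... | inj₁ no-gap = subst (λ t → Chain t T₂ m) (sym S≡T₂)
                        (subst (Chain T₂ T₂) (trans (sym inv-T₂) (trans (cong inv (sym S≡T₂)) count)) done)
    where
    S≡T₂ : S ≡ T₂
    S≡T₂ = rightmost-injective 0 S T₂ (trans size-S (sym size-T₂))
             λ a _ a<n → ≤-antisym (below a) (≮⇒≥ (no-gap a (subst (a <_) size-S a<n)))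
  ... | inj₂ gap with descend S size-S below gap | m
  ...   | S′ , p , below′ , one-less | zero = ⊥-elim (1+n≢0 (trans (sym one-less) count))
  ...   | S′ , p , below′ , one-less | suc m′ =
    step (p ◅ ε , λ S≡S′ → 1+n≢n (trans (sym one-less) (cong inv S≡S′)))
      (chain-exists m′ S′ (trans (sym (rotation-size p)) size-S) below′
        (suc-injective (trans (sym one-less) count)))

module Dictionary (n : ℕ) (_◁_ : Rel n) (T₁ T₂ : Tree) (size-T₂ : size T₂ ≡ n)
                  (corr : Corresponds _◁_ T₁ T₂) where

  g f : ℕ → ℕ
  g = rightmost 0 T₁
  f = rightmost 0 T₂

  decr⇒≤g : ∀ k b → toℕ k < toℕ b → b ◁ k → toℕ b ≤ g (toℕ k)
  decr⇒≤g k b k<b b◁k = inRight⇒≤rightmost (Equivalence.to (proj₁ (corr k b k<b)) b◁k)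

  decr-witness : ∀ (a b : Fin n) {k} → k < toℕ b → toℕ a ≤ k → toℕ b ≤ g k →
                 Σ (Fin n) λ k′ → toℕ a ≤ toℕ k′ × toℕ k′ < toℕ b × b ◁ k′
  decr-witness a b {k} k<b a≤k b≤gk =
    fromℕ< k<n , subst (toℕ a ≤_) (sym k′≡k) a≤k , k′<b ,
    Equivalence.from (proj₁ (corr (fromℕ< k<n) b k′<b))
      (≤rightmost⇒inRight 0 T₁ _ _ k′<b (subst (λ m → toℕ b ≤ g m) (sym k′≡k) b≤gk))
    where
    k<n : k < n
    k<n = <-trans k<b (toℕ<n b)
    k′≡k : toℕ (fromℕ< k<n) ≡ k
    k′≡k = toℕ-fromℕ< k<n
    k′<b : toℕ (fromℕ< k<n) < toℕ b
    k′<b = subst (_< toℕ b) (sym k′≡k) k<b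

  incr⇒f< : ∀ a k → toℕ a < toℕ k → a ◁ k → f (toℕ a) < toℕ k
  incr⇒f< a k a<k a◁k = inLeft⇒rightmost< (Equivalence.to (proj₂ (corr a k a<k)) a◁k)

  -- Conversely, if the subtree of a in T₂ ends before b, the next label
  -- k = f a + 1 ≤ b has a in its left subtree, so a ◁ k.
  incr-witness : ∀ a b → f (toℕ a) < toℕ b →
                 Σ (Fin n) λ k → toℕ a < toℕ k × toℕ k ≤ toℕ b × a ◁ k
  incr-witness a b fa<b =
    k , a<k , subst (_≤ toℕ b) (sym k≡next) fa<b ,
    Equivalence.from (proj₂ (corr a k a<k))
      (subst (InLeft 0 T₂ (toℕ a)) (sym k≡next)
        (inLeft-next 0 T₂ (toℕ a) z≤n (subst (suc (f (toℕ a)) <_) (sym size-T₂) next<n)))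
    where
    next<n : suc (f (toℕ a)) < n
    next<n = ≤-<-trans fa<b (toℕ<n b)
    k : Fin n
    k = fromℕ< next<n
    k≡next : toℕ k ≡ suc (f (toℕ a))
    k≡next = toℕ-fromℕ< next<n
    a<k : toℕ a < toℕ k
    a<k = subst (toℕ a <_) (sym k≡next) (s≤s (rightmost-≥ 0 T₂ (toℕ a)))

  tamari⇒inversion : ∀ a b → TamariInversion _◁_ (a , b) → InversionPair g f (a , b)
  tamari⇒inversion a b (a<b , no-decr , no-incr) =
    a<b , ≮⇒≥ (λ fa<b → no-incr (incr-witness a b fa<b)) ,
    λ k<b a≤k → ≰⇒> (λ b≤gk → no-decr (decr-witness a b k<b a≤k b≤gk))

  inversion⇒tamari : ∀ a b → InversionPair g f (a , b) → TamariInversion _◁_ (a , b)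
  inversion⇒tamari a b (a<b , b≤fa , before-b) = a<b , no-decr , no-incr
    where
    no-decr : ¬ Σ (Fin n) λ k → toℕ a ≤ toℕ k × toℕ k < toℕ b × b ◁ k
    no-decr (k , a≤k , k<b , b◁k) = <-irrefl refl (<-≤-trans (before-b k<b a≤k) (decr⇒≤g k b k<b b◁k))
    no-incr : ¬ Σ (Fin n) λ k → toℕ a < toℕ k × toℕ k ≤ toℕ b × a ◁ k
    no-incr (k , a<k , k≤b , a◁k) = <-irrefl refl (<-≤-trans (≤-<-trans b≤fa (incr⇒f< a k a<k a◁k)) k≤b)

  tamariInversions : HasCard (TamariInversion _◁_) (inversionCount n g f)
  tamariInversions =
    filter (inversionPair? g f) (pairs n) ,
    Unique.filter⁺ (inversionPair? g f) (pairs-unique n) ,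
    (λ (a , b) → mk⇔
      (λ m → inversion⇒tamari a b (proj₂ (∈-filter⁻ (inversionPair? g f) {xs = pairs n} m)))
      (λ t → ∈-filter⁺ (inversionPair? g f) (∈-pairs n (a , b)) (tamari⇒inversion a b t))) ,
    refl

-- Proposition 3.9: dist(I) is the number of Tamari inversions of I.

proposition3p9 : (n : ℕ) (_◁_ : Rel n) → IsIntervalPoset _◁_ →
    (T₁ T₂ : Tree) → size T₁ ≡ n → size T₂ ≡ n → T₁ ≤T T₂ →
    Corresponds _◁_ T₁ T₂ →
    Σ ℕ λ d → IsDist T₁ T₂ d × HasCard (TamariInversion _◁_) d
proposition3p9 n _◁_ _ T₁ T₂ size-T₁ size-T₂ T₁≤T₂ corr =
  inv T₁ , (longest , λ k c → chain-bound k c size-T₁) , tamariInversions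
  where
  open Distance n T₂ size-T₂ using (inv; chain-bound; chain-exists)
  open Dictionary n _◁_ T₁ T₂ size-T₂ corr using (tamariInversions)
  longest : Chain T₁ T₂ (inv T₁)
  longest = chain-exists (inv T₁) T₁ size-T₁ (≤T-monotone 0 T₁≤T₂) refl
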